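{- Let $\pi\in S_{\mathbb Z}$, $i\in\mathbb Z$, and let $a_1\cdots a_{N}$ be a reduced word for $\pi$. Fix $1\le j_0\le N+1$ and let $w$ be the word of length $N+1$ obtained by inserting the symbol $\infty$ at position $j_0$. Run the following procedure (Monk insertion): set $j:=j_0$; repeat: replace $w[j]$ by $\max\{k\in\mathbb Z: k<w[j],\ \ell_w(j,k)\le i<\ell_w(j,k+1)\}$; if the resulting word is reduced, stop and output it; otherwise set $j$ to the leftmost position $t$ such that deleting the $t$-th letter of $w$ gives a reduced word, and repeat. Then this procedure terminates, and its output is a word for $\pi\,t_{ab}$ for some integers $a\le i<b$.
   Context: $S_{\mathbb Z}$ is the group of permutations of $\mathbb Z$ fixing all but finitely many integers, generated by $s_h=(h,h+1)$, $h\in\mathbb Z$; $t_{ab}$ is the transposition of $a$ and $b$. A word $u_1\cdots u_r$ (letters in $\mathbb Z$) is a word for $s_{u_1}\cdots s_{u_r}$; it is reduced if no shorter word gives the same permutation. Every integer is $<\infty$. For a word $w=u_1\cdots u_r$, where a letter $\infty$ is treated as the identity ($s_\infty=\mathrm{id}$), and $0\le j\le r$, define the wiring-diagram labels $\ell_w(j,k)=(s_{u_r}\circ s_{u_{r-1}}\circ\cdots\circ s_{u_{j+1}})(k)$ for $k\in\mathbb Z$ (the label at height $k$ in column $j$; column $r$ is the identity). Since $\ell_w(j,\cdot)$ depends only on letters to the right of position $j$, it is unaffected by changing $w[j]$. -}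

module Defs where

open import Data.Nat as ℕ using (ℕ; zero; suc; _∸_)
open import Data.Integer as ℤ using (ℤ; _+_; _≤_; _<_; 1ℤ)
open import Data.List using (List; []; _∷_; length; map; foldr; foldl; drop; take; _++_)
open import Data.Unit using (⊤)
open import Data.Empty using (⊥)
open import Data.Product using (Σ; _×_; _,_; ∃)
open import Relation.Nullary using (¬_; yes; no)
open import Relation.Binary.PropositionalEquality using (_≡_)

-- Letters: integers or the symbol ∞ (treated as the identity permutation).
data ℤ∞ : Set where
  fin : ℤ → ℤ∞
  ∞   : ℤ∞

_<∞_ : ℤ → ℤ∞ → Set
k <∞ fin n = k < n
k <∞ ∞     = ⊤

t : ℤ → ℤ → ℤ → ℤ
t a b x with x ℤ.≟ a
... | yes _ = b
... | no _ with x ℤ.≟ b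
...   | yes _ = a
...   | no _  = x

s : ℤ → ℤ → ℤ
s h = t h (h + 1ℤ)

s∞ : ℤ∞ → ℤ → ℤ
s∞ (fin h) = s h
s∞ ∞       = λ x → x

Word : Set
Word = List ℤ∞

perm : Word → ℤ → ℤ
perm w x = foldr (λ u y → s∞ u y) x w

⌊_⌋ : List ℤ → Word
⌊ v ⌋ = map fin v

Reduced : Word → Set
Reduced w = ∀ (v : List ℤ) → length v ℕ.< length w → ¬ (∀ x → perm ⌊ v ⌋ x ≡ perm w x)

-- wiring-diagram label ℓ_w(j,k) = (s_{u_r} ∘ ⋯ ∘ s_{u_{j+1}})(k)
ℓ : Word → ℕ → ℤ → ℤ
ℓ w j k = foldl (λ y u → s∞ u y) k (drop j w)

-- list utilities with 1-based positions (as in the paper)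
-- w [ j ]≔ x : replace the j-th letter (1-based)
setAt : Word → ℕ → ℤ∞ → Word
setAt []      _             _ = []
setAt (u ∷ w) zero          _ = u ∷ w
setAt (u ∷ w) (suc zero)    x = x ∷ w
setAt (u ∷ w) (suc (suc j)) x = u ∷ setAt w (suc j) x

_at_≡_ : Word → ℕ → ℤ∞ → Set
[]      at _           ≡ x = ⊥
(u ∷ w) at zero        ≡ x = ⊥
(u ∷ w) at suc zero    ≡ x = u ≡ x
(u ∷ w) at suc (suc j) ≡ x = w at suc j ≡ x

deleteAt : Word → ℕ → Word
deleteAt []      _             = []
deleteAt (u ∷ w) zero          = u ∷ w
deleteAt (u ∷ w) (suc zero)    = w
deleteAt (u ∷ w) (suc (suc j)) = u ∷ deleteAt w (suc j)

insert∞ : List ℤ → ℕ → Word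
insert∞ a j0 = take (j0 ∸ 1) ⌊ a ⌋ ++ ∞ ∷ drop (j0 ∸ 1) ⌊ a ⌋

MonkCond : ℤ → Word → ℕ → ℤ → Set
MonkCond i w j k = ℓ w j k ≤ i × i < ℓ w j (k + 1ℤ)

IsMonkMax : ℤ → Word → ℕ → ℤ → Set
IsMonkMax i w j m =
  Σ ℤ∞ λ c → (w at j ≡ c) × (m <∞ c) × MonkCond i w j m ×
    (∀ k → k <∞ c → MonkCond i w j k → k ≤ m)

LeftmostDel : Word → ℕ → Set
LeftmostDel w p =
  (1 ℕ.≤ p) × (p ℕ.≤ length w) × Reduced (deleteAt w p) ×
    (∀ q → 1 ℕ.≤ q → q ℕ.< p → ¬ Reduced (deleteAt w q))

-- Each step is deterministic (the max and the leftmost position are unique),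
-- so the existence of such a finite run is exactly termination of the procedure.
data MonkRun (i : ℤ) : Word → ℕ → Word → Set where
  stop : ∀ {w j m} → IsMonkMax i w j m →
         Reduced (setAt w j (fin m)) →
         MonkRun i w j (setAt w j (fin m))
  next : ∀ {w j m p out} → IsMonkMax i w j m →
         ¬ Reduced (setAt w j (fin m)) →
         LeftmostDel (setAt w j (fin m)) p →
         MonkRun i (setAt w j (fin m)) p out →
         MonkRun i w j out

module Submission where

-- Label the crossing of each letter of a word by the pair of wires it swaps. A word's permutation
-- inverts a pair {x, y} exactly when the word crosses it an odd number of times, so a word is
-- reduced iff its crossings are distinct. A Monk step writes m into the current letter of A c B,
-- turning the permutation π of the reduced word A B into π t_αβ with α = ℓ(m) ≤ i < β = ℓ(m + 1).
-- The crossings of A are only relabelled by t_αβ, and a third wire crossed with α on one side of m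
-- and with β on the other would lie between α and β and force A B to cross α and β too; so A m B
-- is reduced unless some letter of A crosses {α, β} again. Deleting the leftmost such letter c'
-- then leaves a word for π of the original length, hence reduced, and c' carries β on its left,
-- so i < ℓ(c') and the next maximum exists. Each step acts strictly left of the previous one.

open import Defs
open import Data.Nat as ℕ using (ℕ; zero; suc; z≤n; s≤s)
import Data.Nat.Properties as ℕP
open import Data.Integer as ℤ using (ℤ; _≤_; _<_; _+_; _-_; 0ℤ; 1ℤ; +_; _⊓_; _⊔_)
import Data.Integer.Properties as ℤP
open import Data.Integer.Tactic.RingSolver using (solve-∀)
open import Data.List using (List; []; _∷_; length; map; _++_; foldl; drop; take)
import Data.List.Properties as LP
open import Data.List.Membership.Propositional using (_∈_; _∉_)
import Data.List.Membership.Propositional.Properties as MP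
open import Data.List.Relation.Unary.Any using (here; there)
open import Data.List.Relation.Unary.All as All using (All; []; _∷_)
import Data.List.Relation.Unary.All.Properties as AllP
open import Data.List.Relation.Unary.AllPairs using ([]; _∷_)
open import Data.List.Relation.Unary.Unique.Propositional using (Unique)
import Data.List.Relation.Unary.Unique.Propositional.Properties as UniqueP
open import Data.List.Relation.Binary.Subset.Propositional using (_⊆_)
open import Data.List.Relation.Binary.Disjoint.Propositional using (Disjoint)
open import Data.Product using (Σ; _×_; _,_; proj₁; proj₂)
import Data.Product.Properties as ×P
open import Data.Sum using (_⊎_; inj₁; inj₂)
open import Data.Empty using (⊥; ⊥-elim)
open import Data.Unit using (tt)
open import Data.Bool using (Bool; true; false; not; _xor_)
open import Data.Bool.Properties using (xor-assoc; xor-comm; xor-identityʳ; not-injective)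
open import Function using (_∘_)
open import Function.Bundles using (mk⇔)
open import Relation.Nullary using (¬_; Dec; yes; no; does)
open import Relation.Nullary.Decidable using (dec-true; dec-false; does-⇔; _×-dec_)
open import Relation.Unary using (Decidable)
open import Relation.Binary using (DecidableEquality; Tri; tri<; tri≈; tri>)
open import Relation.Binary.PropositionalEquality

i<i+1 : ∀ x → x < x + 1ℤ
i<i+1 x = subst (x <_) (ℤP.+-comm 1ℤ x) (ℤP.suc[i]≤j⇒i<j ℤP.≤-refl)

i≢i+1 : ∀ x → x ≢ x + 1ℤ
i≢i+1 x x≡x+1 = ℤP.<-irrefl x≡x+1 (i<i+1 x)

<⇒+1≤ : ∀ {x y} → x < y → x + 1ℤ ≤ y
<⇒+1≤ {x} x<y = subst (_≤ _) (ℤP.+-comm 1ℤ x) (ℤP.i<j⇒suc[i]≤j x<y)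

<+1⇒≤ : ∀ {x y} → x < y + 1ℤ → x ≤ y
<+1⇒≤ {x} {y} x<y+1 =
  subst (x ≤_) (trans (cong ℤ.pred (ℤP.+-comm y 1ℤ)) (ℤP.pred-suc y)) (ℤP.i<j⇒i≤pred[j] x<y+1)

_<ᵇ_ : ℤ → ℤ → Bool
x <ᵇ y = does (x ℤ.<? y)

<ᵇ⇒< : ∀ {x y} → x <ᵇ y ≡ true → x < y
<ᵇ⇒< {x} {y} eq with x ℤ.<? y
... | yes x<y = x<y
<ᵇ⇒< () | no _

<ᵇ-false⇒> : ∀ {x y} → x ≢ y → x <ᵇ y ≡ false → y < x
<ᵇ-false⇒> {x} {y} x≢y eq with x ℤ.<? y
... | no x≮y = ℤP.≤∧≢⇒< (ℤP.≮⇒≥ x≮y) (x≢y ∘ sym)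
<ᵇ-false⇒> x≢y () | yes _

<ᵇ-adjacent : ∀ m {r} → r ≢ m + 1ℤ → m <ᵇ r ≡ (m + 1ℤ) <ᵇ r
<ᵇ-adjacent m {r} r≢m+1 with m ℤ.<? r
... | yes m<r = sym (dec-true (_ ℤ.<? r) (ℤP.≤∧≢⇒< (<⇒+1≤ m<r) (r≢m+1 ∘ sym)))
... | no m≮r = sym (dec-false (_ ℤ.<? r) (m≮r ∘ ℤP.<-trans (i<i+1 m)))

false≢true : false ≢ true
false≢true ()

xor-cancelˡ : ∀ a {p q} → a xor p ≡ a xor q → p ≡ q
xor-cancelˡ false eq = eq
xor-cancelˡ true eq = not-injective eq

xor-differs : ∀ a b {p q} → a xor p ≡ b xor q → p ≢ q → a ≢ b
xor-differs a .a eq p≢q refl = p≢q (xor-cancelˡ a eq)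

data TranspositionView (a b x : ℤ) : Set where
  at-a  : x ≡ a → TranspositionView a b x
  at-b  : x ≢ a → x ≡ b → TranspositionView a b x
  fixed : x ≢ a → x ≢ b → TranspositionView a b x

transpositionView : ∀ a b x → TranspositionView a b x
transpositionView a b x with x ℤ.≟ a | x ℤ.≟ b
... | yes x≡a | _       = at-a x≡a
... | no x≢a  | yes x≡b = at-b x≢a x≡b
... | no x≢a  | no x≢b  = fixed x≢a x≢b

t-a : ∀ a b → t a b a ≡ b
t-a a b with a ℤ.≟ a
... | yes _ = refl
... | no a≢a = ⊥-elim (a≢a refl)

t-b : ∀ a b → t a b b ≡ a
t-b a b with b ℤ.≟ a
... | yes b≡a = b≡a
... | no _ with b ℤ.≟ b
...   | yes _ = refl
...   | no b≢b = ⊥-elim (b≢b refl)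

t-fix : ∀ {a b x} → x ≢ a → x ≢ b → t a b x ≡ x
t-fix {a} {b} {x} x≢a x≢b with x ℤ.≟ a
... | yes x≡a = ⊥-elim (x≢a x≡a)
... | no _ with x ℤ.≟ b
...   | yes x≡b = ⊥-elim (x≢b x≡b)
...   | no _ = refl

t-involutive : ∀ a b x → t a b (t a b x) ≡ x
t-involutive a b x with transpositionView a b x
... | at-a refl       = trans (cong (t a b) (t-a a b)) (t-b a b)
... | at-b _ refl     = trans (cong (t a b) (t-b a b)) (t-a a b)
... | fixed x≢a x≢b   = trans (cong (t a b) (t-fix x≢a x≢b)) (t-fix x≢a x≢b)

t-comm : ∀ a b x → t a b x ≡ t b a x
t-comm a b x with transpositionView a b x
... | at-a refl       = trans (t-a a b) (sym (t-b b a))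
... | at-b _ refl     = trans (t-b a b) (sym (t-a b a))
... | fixed x≢a x≢b   = trans (t-fix x≢a x≢b) (sym (t-fix x≢b x≢a))

t-injective : ∀ a b {x y} → t a b x ≡ t a b y → x ≡ y
t-injective a b {x} {y} eq =
  trans (sym (t-involutive a b x)) (trans (cong (t a b) eq) (t-involutive a b y))

⟦_⟧ : List ℤ → ℤ → ℤ
⟦ v ⟧ = perm ⌊ v ⌋

-- ⟦ v ⟧⁻¹ k = ℓ ⌊ v ⌋ 0 k, the label of height k at the left end of the wiring diagram of v.
⟦_⟧⁻¹ : List ℤ → ℤ → ℤ
⟦ v ⟧⁻¹ k = foldl (λ y u → s∞ u y) k ⌊ v ⌋

⟦⟧-++ : ∀ X Y x → ⟦ X ++ Y ⟧ x ≡ ⟦ X ⟧ (⟦ Y ⟧ x)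
⟦⟧-++ []      Y x = refl
⟦⟧-++ (u ∷ X) Y x = cong (s u) (⟦⟧-++ X Y x)

⟦⟧⁻¹-++ : ∀ X Y k → ⟦ X ++ Y ⟧⁻¹ k ≡ ⟦ Y ⟧⁻¹ (⟦ X ⟧⁻¹ k)
⟦⟧⁻¹-++ []      Y k = refl
⟦⟧⁻¹-++ (u ∷ X) Y k = ⟦⟧⁻¹-++ X Y (s u k)

⟦⟧-inverseʳ : ∀ v x → ⟦ v ⟧ (⟦ v ⟧⁻¹ x) ≡ x
⟦⟧-inverseʳ []      x = refl
⟦⟧-inverseʳ (u ∷ v) x = trans (cong (s u) (⟦⟧-inverseʳ v (s u x))) (t-involutive u _ x)

⟦⟧-inverseˡ : ∀ v x → ⟦ v ⟧⁻¹ (⟦ v ⟧ x) ≡ x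
⟦⟧-inverseˡ []      x = refl
⟦⟧-inverseˡ (u ∷ v) x = trans (cong ⟦ v ⟧⁻¹ (t-involutive u _ (⟦ v ⟧ x))) (⟦⟧-inverseˡ v x)

⟦⟧-injective : ∀ v {x y} → ⟦ v ⟧ x ≡ ⟦ v ⟧ y → x ≡ y
⟦⟧-injective v {x} {y} eq =
  trans (sym (⟦⟧-inverseˡ v x)) (trans (cong ⟦ v ⟧⁻¹ eq) (⟦⟧-inverseˡ v y))

⟦⟧⁻¹-injective : ∀ v {x y} → ⟦ v ⟧⁻¹ x ≡ ⟦ v ⟧⁻¹ y → x ≡ y
⟦⟧⁻¹-injective v {x} {y} eq =
  trans (sym (⟦⟧-inverseʳ v x)) (trans (cong ⟦ v ⟧ eq) (⟦⟧-inverseʳ v y))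

-- The transposition of the two wires crossing at a letter u placed in front of B.
τ : List ℤ → ℤ → ℤ → ℤ
τ B u = t (⟦ B ⟧⁻¹ u) (⟦ B ⟧⁻¹ (u + 1ℤ))

⟦⟧⁻¹-s : ∀ B u y → ⟦ B ⟧⁻¹ (s u y) ≡ τ B u (⟦ B ⟧⁻¹ y)
⟦⟧⁻¹-s B u y with transpositionView u (u + 1ℤ) y
... | at-a refl   = trans (cong ⟦ B ⟧⁻¹ (t-a u (u + 1ℤ))) (sym (t-a (⟦ B ⟧⁻¹ u) (⟦ B ⟧⁻¹ (u + 1ℤ))))
... | at-b _ refl = trans (cong ⟦ B ⟧⁻¹ (t-b u (u + 1ℤ))) (sym (t-b (⟦ B ⟧⁻¹ u) (⟦ B ⟧⁻¹ (u + 1ℤ))))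
... | fixed y≢u y≢u+1 = trans (cong ⟦ B ⟧⁻¹ (t-fix y≢u y≢u+1))
      (sym (t-fix (y≢u ∘ ⟦⟧⁻¹-injective B) (y≢u+1 ∘ ⟦⟧⁻¹-injective B)))

⟦⟧-insert : ∀ A u B x → ⟦ A ++ u ∷ B ⟧ x ≡ ⟦ A ++ B ⟧ (τ B u x)
⟦⟧-insert A u B x = begin
  ⟦ A ++ u ∷ B ⟧ x                           ≡⟨ ⟦⟧-++ A (u ∷ B) x ⟩
  ⟦ A ⟧ (s u (⟦ B ⟧ x))                      ≡⟨ cong ⟦ A ⟧ (sym (⟦⟧-inverseʳ B _)) ⟩
  ⟦ A ⟧ (⟦ B ⟧ (⟦ B ⟧⁻¹ (s u (⟦ B ⟧ x))))    ≡⟨ cong (⟦ A ⟧ ∘ ⟦ B ⟧) (⟦⟧⁻¹-s B u (⟦ B ⟧ x)) ⟩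
  ⟦ A ⟧ (⟦ B ⟧ (τ B u (⟦ B ⟧⁻¹ (⟦ B ⟧ x))))  ≡⟨ cong (⟦ A ⟧ ∘ ⟦ B ⟧ ∘ τ B u) (⟦⟧-inverseˡ B x) ⟩
  ⟦ A ⟧ (⟦ B ⟧ (τ B u x))                    ≡⟨ sym (⟦⟧-++ A B _) ⟩
  ⟦ A ++ B ⟧ (τ B u x)                       ∎
  where open ≡-Reasoning

⟦⟧⁻¹-insert : ∀ A u B k → ⟦ A ++ u ∷ B ⟧⁻¹ k ≡ τ B u (⟦ A ++ B ⟧⁻¹ k)
⟦⟧⁻¹-insert A u B k = begin
  ⟦ A ++ u ∷ B ⟧⁻¹ k            ≡⟨ ⟦⟧⁻¹-++ A (u ∷ B) k ⟩
  ⟦ B ⟧⁻¹ (s u (⟦ A ⟧⁻¹ k))     ≡⟨ ⟦⟧⁻¹-s B u _ ⟩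
  τ B u (⟦ B ⟧⁻¹ (⟦ A ⟧⁻¹ k))   ≡⟨ cong (τ B u) (sym (⟦⟧⁻¹-++ A B k)) ⟩
  τ B u (⟦ A ++ B ⟧⁻¹ k)        ∎
  where open ≡-Reasoning

-- Crossings

-- Crossings are unordered pairs of wire labels, stored in increasing order.
pair : ℤ → ℤ → ℤ × ℤ
pair a b with a ℤ.≤? b
... | yes _ = a , b
... | no _  = b , a

Ascending : ℤ × ℤ → Set
Ascending (x , y) = x < y

pair-cases : ∀ a b → pair a b ≡ (a , b) ⊎ pair a b ≡ (b , a)
pair-cases a b with a ℤ.≤? b
... | yes _ = inj₁ refl
... | no _  = inj₂ refl

pair-comm : ∀ a b → pair a b ≡ pair b a
pair-comm a b with a ℤ.≤? b | b ℤ.≤? a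
... | yes a≤b | yes b≤a = cong₂ _,_ (ℤP.≤-antisym a≤b b≤a) (ℤP.≤-antisym b≤a a≤b)
... | yes _   | no _    = refl
... | no _    | yes _   = refl
... | no a≰b  | no b≰a  = ⊥-elim (a≰b (ℤP.<⇒≤ (ℤP.≰⇒> b≰a)))

pair-< : ∀ {a b} → a < b → pair a b ≡ (a , b)
pair-< {a} {b} a<b with a ℤ.≤? b
... | yes _   = refl
... | no a≰b = ⊥-elim (a≰b (ℤP.<⇒≤ a<b))

pair-ascending : ∀ {a b} → a ≢ b → Ascending (pair a b)
pair-ascending {a} {b} a≢b with a ℤ.≤? b
... | yes a≤b = ℤP.≤∧≢⇒< a≤b a≢b
... | no a≰b  = ℤP.≰⇒> a≰b

pair-injective : ∀ {a b c d} → pair a b ≡ pair c d → (a ≡ c × b ≡ d) ⊎ (a ≡ d × b ≡ c)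
pair-injective {a} {b} {c} {d} eq with pair-cases a b | pair-cases c d
... | inj₁ p | inj₁ q = inj₁ (×P.,-injective (trans (sym p) (trans eq q)))
... | inj₁ p | inj₂ q = inj₂ (×P.,-injective (trans (sym p) (trans eq q)))
... | inj₂ p | inj₁ q = let b≡c , a≡d = ×P.,-injective (trans (sym p) (trans eq q)) in inj₂ (a≡d , b≡c)
... | inj₂ p | inj₂ q = let b≡d , a≡c = ×P.,-injective (trans (sym p) (trans eq q)) in inj₁ (a≡c , b≡d)

t-unordered : ∀ {a b c d} → pair a b ≡ pair c d → ∀ x → t a b x ≡ t c d x
t-unordered eq x with pair-injective eq
... | inj₁ (refl , refl) = refl
... | inj₂ (refl , refl) = t-comm _ _ x

t-pair : ℤ → ℤ → ℤ × ℤ → ℤ × ℤ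
t-pair a b (x , y) = pair (t a b x) (t a b y)

t-pair-pair : ∀ a b x y → t-pair a b (pair x y) ≡ pair (t a b x) (t a b y)
t-pair-pair a b x y with pair-cases x y
... | inj₁ p rewrite p = refl
... | inj₂ p rewrite p = pair-comm _ _

t-pair-injective : ∀ a b {p q} → Ascending p → Ascending q → t-pair a b p ≡ t-pair a b q → p ≡ q
t-pair-injective a b {x , y} {x' , y'} x<y x'<y' eq with pair-injective eq
... | inj₁ (ex , ey) = cong₂ _,_ (t-injective a b ex) (t-injective a b ey)
... | inj₂ (ex , ey) = ⊥-elim (ℤP.<-asym x<y (subst₂ _<_ (sym (t-injective a b ey)) (sym (t-injective a b ex)) x'<y'))

-- The wires crossing at the letter u of the word u ∷ B.
crossing : List ℤ → ℤ → ℤ × ℤ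
crossing B u = pair (⟦ B ⟧⁻¹ u) (⟦ B ⟧⁻¹ (u + 1ℤ))

crossings : List ℤ → List (ℤ × ℤ)
crossings []      = []
crossings (u ∷ v) = crossing v u ∷ crossings v

prefixCrossings : List ℤ → List ℤ → List (ℤ × ℤ)
prefixCrossings []      Z = []
prefixCrossings (a ∷ A) Z = crossing (A ++ Z) a ∷ prefixCrossings A Z

crossings-++ : ∀ A B → crossings (A ++ B) ≡ prefixCrossings A B ++ crossings B
crossings-++ []      B = refl
crossings-++ (a ∷ A) B = cong (crossing (A ++ B) a ∷_) (crossings-++ A B)

crossing-ascending : ∀ Z u → Ascending (crossing Z u)
crossing-ascending Z u = pair-ascending (i≢i+1 u ∘ ⟦⟧⁻¹-injective Z)

prefixCrossings-ascending : ∀ A Z → All Ascending (prefixCrossings A Z)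
prefixCrossings-ascending []      Z = []
prefixCrossings-ascending (a ∷ A) Z = crossing-ascending (A ++ Z) a ∷ prefixCrossings-ascending A Z

prefixCrossings-insert : ∀ A u B →
  prefixCrossings A (u ∷ B) ≡ map (t-pair (⟦ B ⟧⁻¹ u) (⟦ B ⟧⁻¹ (u + 1ℤ))) (prefixCrossings A B)
prefixCrossings-insert []      u B = refl
prefixCrossings-insert (a ∷ A) u B = cong₂ _∷_ head (prefixCrossings-insert A u B)
  where
  head : crossing (A ++ u ∷ B) a ≡ t-pair (⟦ B ⟧⁻¹ u) (⟦ B ⟧⁻¹ (u + 1ℤ)) (crossing (A ++ B) a)
  head = trans (cong₂ pair (⟦⟧⁻¹-insert A u B a) (⟦⟧⁻¹-insert A u B (a + 1ℤ)))
               (sym (t-pair-pair _ _ (⟦ A ++ B ⟧⁻¹ a) (⟦ A ++ B ⟧⁻¹ (a + 1ℤ))))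

∈-crossings⁻ : ∀ v {e} → e ∈ crossings v →
  Σ (List ℤ) λ M → Σ ℤ λ u → Σ (List ℤ) λ B → v ≡ M ++ u ∷ B × crossing B u ≡ e
∈-crossings⁻ (u ∷ v) (here refl) = [] , u , v , refl , refl
∈-crossings⁻ (u ∷ v) (there e∈) with ∈-crossings⁻ v e∈
... | M , u' , B , refl , eq = u ∷ M , u' , B , refl , eq

∈-prefixCrossings⁻ : ∀ A Z {e} → e ∈ prefixCrossings A Z →
  Σ (List ℤ) λ A₁ → Σ ℤ λ c → Σ (List ℤ) λ A₂ → A ≡ A₁ ++ c ∷ A₂ × crossing (A₂ ++ Z) c ≡ e
∈-prefixCrossings⁻ (a ∷ A) Z (here refl) = [] , a , A , refl , refl
∈-prefixCrossings⁻ (a ∷ A) Z (there e∈) with ∈-prefixCrossings⁻ A Z e∈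
... | A₁ , c , A₂ , refl , eq = a ∷ A₁ , c , A₂ , refl , eq

-- Parity of crossings and the order of wires

_≟₂_ : DecidableEquality (ℤ × ℤ)
_≟₂_ = ×P.≡-dec ℤ._≟_ ℤ._≟_

occursOddly : List (ℤ × ℤ) → ℤ × ℤ → Bool
occursOddly []       e = false
occursOddly (p ∷ ps) e = does (p ≟₂ e) xor occursOddly ps e

occursOddly-∉ : ∀ ps {e} → e ∉ ps → occursOddly ps e ≡ false
occursOddly-∉ []       e∉ = refl
occursOddly-∉ (p ∷ ps) e∉ =
  cong₂ _xor_ (dec-false (p ≟₂ _) (e∉ ∘ here ∘ sym)) (occursOddly-∉ ps (e∉ ∘ there))

occursOddly-unique : ∀ {ps e} → Unique ps → e ∈ ps → occursOddly ps e ≡ true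
occursOddly-unique {p ∷ ps} u@(_ ∷ _) (here refl) =
  cong₂ _xor_ (dec-true (p ≟₂ p) refl) (occursOddly-∉ ps (UniqueP.Unique[x∷xs]⇒x∉xs u))
occursOddly-unique {p ∷ ps} (p≢ps ∷ u) (there e∈ps) =
  cong₂ _xor_ (dec-false (p ≟₂ _) (All.lookup p≢ps e∈ps)) (occursOddly-unique u e∈ps)

occursOddly⇒∈ : ∀ ps {e} → occursOddly ps e ≡ true → e ∈ ps
occursOddly⇒∈ (p ∷ ps) {e} odd with p ≟₂ e
... | yes p≡e = here (sym p≡e)
... | no _    = there (occursOddly⇒∈ ps odd)

s-monotone : ∀ u {a b} → a < b → (a , b) ≢ (u , u + 1ℤ) → s u a < s u b
s-monotone u {a} {b} a<b ab≢ with transpositionView u (u + 1ℤ) a | transpositionView u (u + 1ℤ) b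
... | at-a refl | at-a refl = ⊥-elim (ℤP.<-irrefl refl a<b)
... | at-a refl | at-b _ refl = ⊥-elim (ab≢ refl)
... | at-a refl | fixed b≢u b≢u+1 rewrite t-a u (u + 1ℤ) | t-fix b≢u b≢u+1 =
  ℤP.≤∧≢⇒< (<⇒+1≤ a<b) (b≢u+1 ∘ sym)
... | at-b _ refl | at-a refl = ⊥-elim (ℤP.<-asym a<b (i<i+1 u))
... | at-b _ refl | at-b _ refl = ⊥-elim (ℤP.<-irrefl refl a<b)
... | at-b _ refl | fixed b≢u b≢u+1 rewrite t-b u (u + 1ℤ) | t-fix b≢u b≢u+1 =
  ℤP.<-trans (i<i+1 u) a<b
... | fixed a≢u a≢u+1 | at-a refl rewrite t-a u (u + 1ℤ) | t-fix a≢u a≢u+1 =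
  ℤP.<-trans a<b (i<i+1 u)
... | fixed a≢u a≢u+1 | at-b _ refl rewrite t-b u (u + 1ℤ) | t-fix a≢u a≢u+1 =
  ℤP.≤∧≢⇒< (<+1⇒≤ a<b) a≢u
... | fixed a≢u a≢u+1 | fixed b≢u b≢u+1 rewrite t-fix a≢u a≢u+1 | t-fix b≢u b≢u+1 = a<b

s-<ᵇ : ∀ u {p q} → p ≢ q → (s u p <ᵇ s u q) ≡ (p <ᵇ q) xor does ((u , u + 1ℤ) ≟₂ pair p q)
s-<ᵇ u {p} {q} p≢q with (u , u + 1ℤ) ≟₂ pair p q
... | yes eq with pair-injective {u} {u + 1ℤ} {p} {q} (trans (pair-< {u} {u + 1ℤ} (i<i+1 u)) eq)
...   | inj₁ (refl , refl) rewrite t-a u (u + 1ℤ) | t-b u (u + 1ℤ)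
                                 | dec-true (u ℤ.<? (u + 1ℤ)) (i<i+1 u) =
  dec-false ((u + 1ℤ) ℤ.<? u) (ℤP.<-asym (i<i+1 u))
...   | inj₂ (refl , refl) rewrite t-a u (u + 1ℤ) | t-b u (u + 1ℤ)
                                 | dec-false ((u + 1ℤ) ℤ.<? u) (ℤP.<-asym (i<i+1 u)) =
  dec-true (u ℤ.<? (u + 1ℤ)) (i<i+1 u)
s-<ᵇ u {p} {q} p≢q | no pq≢ with ℤP.<-cmp p q
... | tri< p<q _ _ = begin
  s u p <ᵇ s u q          ≡⟨ dec-true (_ ℤ.<? _) (s-monotone u p<q (λ eq → pq≢ (sym (trans (pair-< p<q) eq)))) ⟩
  true                    ≡⟨ sym (cong (_xor false) (dec-true (p ℤ.<? q) p<q)) ⟩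
  (p <ᵇ q) xor false      ∎
  where open ≡-Reasoning
... | tri≈ _ p≡q _ = ⊥-elim (p≢q p≡q)
... | tri> _ _ q<p = begin
  s u p <ᵇ s u q          ≡⟨ dec-false (_ ℤ.<? _) (ℤP.<-asym (s-monotone u q<p q,p≢)) ⟩
  false                   ≡⟨ sym (cong (_xor false) (dec-false (p ℤ.<? q) (ℤP.<-asym q<p))) ⟩
  (p <ᵇ q) xor false      ∎
  where
  open ≡-Reasoning
  q,p≢ : (q , p) ≢ (u , u + 1ℤ)
  q,p≢ eq = pq≢ (sym (trans (pair-comm p q) (trans (pair-< q<p) eq)))

pair-transport : ∀ {f g : ℤ → ℤ} → (∀ x → f (g x) ≡ x) →
  ∀ {a b c d} → pair (g a) (g b) ≡ pair c d → pair a b ≡ pair (f c) (f d)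
pair-transport {f} {g} fg {a} {b} {c} {d} eq with pair-injective eq
... | inj₁ (ga≡c , gb≡d) = cong₂ pair (sym (trans (cong f (sym ga≡c)) (fg a)))
                                      (sym (trans (cong f (sym gb≡d)) (fg b)))
... | inj₂ (ga≡d , gb≡c) = trans (cong₂ pair (sym (trans (cong f (sym ga≡d)) (fg a)))
                                             (sym (trans (cong f (sym gb≡c)) (fg b))))
                                 (pair-comm (f d) (f c))

crossing-relabel : ∀ v u x y →
  does (crossing v u ≟₂ pair x y) ≡ does ((u , u + 1ℤ) ≟₂ pair (⟦ v ⟧ x) (⟦ v ⟧ y))
crossing-relabel v u x y = does-⇔ (mk⇔ to from) (crossing v u ≟₂ pair x y) (_ ≟₂ _)
  where
  to : crossing v u ≡ pair x y → (u , u + 1ℤ) ≡ pair (⟦ v ⟧ x) (⟦ v ⟧ y)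
  to eq = trans (sym (pair-< {u} {u + 1ℤ} (i<i+1 u))) (pair-transport (⟦⟧-inverseʳ v) eq)
  from : (u , u + 1ℤ) ≡ pair (⟦ v ⟧ x) (⟦ v ⟧ y) → crossing v u ≡ pair x y
  from eq = sym (pair-transport (⟦⟧-inverseˡ v) (sym (trans (pair-< {u} {u + 1ℤ} (i<i+1 u)) eq)))

⟦⟧-<ᵇ : ∀ v {x y} → x ≢ y →
  (⟦ v ⟧ x <ᵇ ⟦ v ⟧ y) ≡ (x <ᵇ y) xor occursOddly (crossings v) (pair x y)
⟦⟧-<ᵇ []      {x} {y} _   = sym (xor-identityʳ (x <ᵇ y))
⟦⟧-<ᵇ (u ∷ v) {x} {y} x≢y = begin
  s u (⟦ v ⟧ x) <ᵇ s u (⟦ v ⟧ y)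
    ≡⟨ s-<ᵇ u (x≢y ∘ ⟦⟧-injective v) ⟩
  (⟦ v ⟧ x <ᵇ ⟦ v ⟧ y) xor does ((u , u + 1ℤ) ≟₂ pair (⟦ v ⟧ x) (⟦ v ⟧ y))
    ≡⟨ cong₂ _xor_ (⟦⟧-<ᵇ v x≢y) (sym (crossing-relabel v u x y)) ⟩
  ((x <ᵇ y) xor o) xor d
    ≡⟨ xor-assoc (x <ᵇ y) o d ⟩
  (x <ᵇ y) xor (o xor d)
    ≡⟨ cong ((x <ᵇ y) xor_) (xor-comm o d) ⟩
  (x <ᵇ y) xor (d xor o) ∎
  where
  open ≡-Reasoning
  o = occursOddly (crossings v) (pair x y)
  d = does (crossing v u ≟₂ pair x y)

⟦⟧-preserves : ∀ v {x y} → x < y → pair x y ∉ crossings v → ⟦ v ⟧ x < ⟦ v ⟧ y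
⟦⟧-preserves v {x} {y} x<y xy∉ = <ᵇ⇒< (begin
  ⟦ v ⟧ x <ᵇ ⟦ v ⟧ y                            ≡⟨ ⟦⟧-<ᵇ v (ℤP.<⇒≢ x<y) ⟩
  (x <ᵇ y) xor occursOddly (crossings v) (pair x y) ≡⟨ cong₂ _xor_ (dec-true (x ℤ.<? y) x<y)
                                                                   (occursOddly-∉ (crossings v) xy∉) ⟩
  true                                             ∎)
  where open ≡-Reasoning

⟦⟧-reverses : ∀ v {x y} → x < y → Unique (crossings v) → pair x y ∈ crossings v → ⟦ v ⟧ y < ⟦ v ⟧ x
⟦⟧-reverses v {x} {y} x<y u xy∈ = <ᵇ-false⇒> (ℤP.<⇒≢ x<y ∘ ⟦⟧-injective v) (begin
  ⟦ v ⟧ x <ᵇ ⟦ v ⟧ y                            ≡⟨ ⟦⟧-<ᵇ v (ℤP.<⇒≢ x<y) ⟩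
  (x <ᵇ y) xor occursOddly (crossings v) (pair x y) ≡⟨ cong₂ _xor_ (dec-true (x ℤ.<? y) x<y)
                                                                   (occursOddly-unique u xy∈) ⟩
  false                                            ∎)
  where open ≡-Reasoning

-- Reduced words are the words whose crossings are distinct

module _ {A : Set} where

  Unique-++⁻ˡ : ∀ (xs : List A) {ys} → Unique (xs ++ ys) → Unique xs
  Unique-++⁻ˡ []       _          = []
  Unique-++⁻ˡ (x ∷ xs) (x∉ ∷ u) = AllP.++⁻ˡ xs x∉ ∷ Unique-++⁻ˡ xs u

  Unique-++⁻ʳ : ∀ (xs : List A) {ys} → Unique (xs ++ ys) → Unique ys
  Unique-++⁻ʳ []       u        = u
  Unique-++⁻ʳ (x ∷ xs) (_ ∷ u) = Unique-++⁻ʳ xs u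

  Unique-++⇒Disjoint : ∀ (xs : List A) {ys} → Unique (xs ++ ys) → Disjoint xs ys
  Unique-++⇒Disjoint (x ∷ xs) (x∉ ∷ _) (here refl , v∈ys) = All.lookup (AllP.++⁻ʳ xs x∉) v∈ys refl
  Unique-++⇒Disjoint (x ∷ xs) (_ ∷ u)  (there v∈xs , v∈ys) = Unique-++⇒Disjoint xs u (v∈xs , v∈ys)

  length-<-++-∷ : ∀ (X : List A) c Y → length X ℕ.< length (X ++ c ∷ Y)
  length-<-++-∷ []      c Y = s≤s z≤n
  length-<-++-∷ (_ ∷ X) c Y = s≤s (length-<-++-∷ X c Y)

  Unique-⊆⇒length-≤ : ∀ {xs ys : List A} → Unique xs → xs ⊆ ys → length xs ℕ.≤ length ys
  Unique-⊆⇒length-≤ {[]}     _          _     = z≤n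
  Unique-⊆⇒length-≤ {x ∷ xs} (x∉ ∷ u) xs⊆ys with MP.∈-∃++ (xs⊆ys (here refl))
  ... | us , vs , refl = subst (suc (length xs) ℕ.≤_) (sym (LP.length-++-sucʳ us x vs))
                               (s≤s (Unique-⊆⇒length-≤ u xs⊆us++vs))
    where
    xs⊆us++vs : xs ⊆ us ++ vs
    xs⊆us++vs {z} z∈xs with MP.∈-++⁻ us (xs⊆ys (there z∈xs))
    ... | inj₁ z∈us         = MP.∈-++⁺ˡ z∈us
    ... | inj₂ (here refl)  = ⊥-elim (All.lookup x∉ z∈xs refl)
    ... | inj₂ (there z∈vs) = MP.∈-++⁺ʳ us z∈vs

length-⌊⌋ : ∀ v → length ⌊ v ⌋ ≡ length v
length-⌊⌋ = LP.length-map fin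

crossings-ascending : ∀ v → All Ascending (crossings v)
crossings-ascending []      = []
crossings-ascending (u ∷ v) = crossing-ascending v u ∷ crossings-ascending v

crossings-suffix-unique : ∀ A {B} → Unique (crossings (A ++ B)) → Unique (crossings B)
crossings-suffix-unique A {B} u = Unique-++⁻ʳ (prefixCrossings A B) (subst Unique (crossings-++ A B) u)

-- Two words with the same permutation cross the same pairs an odd number of times, and
-- a word with distinct crossings has no more crossings than any other.
unique⇒reduced : ∀ w → Unique (crossings w) → Reduced ⌊ w ⌋
unique⇒reduced w u v shorter v≗w = ℕP.<-irrefl refl
  (ℕP.<-≤-trans fewer (Unique-⊆⇒length-≤ u crossings-w⊆v))
  where
  fewer : length (crossings v) ℕ.< length (crossings w)
  fewer = subst₂ ℕ._<_ (sym (length-crossings v)) (trans (length-⌊⌋ w) (sym (length-crossings w))) shorter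
    where
    length-crossings : ∀ v → length (crossings v) ≡ length v
    length-crossings []      = refl
    length-crossings (_ ∷ v) = cong suc (length-crossings v)
  crossings-w⊆v : crossings w ⊆ crossings v
  crossings-w⊆v {x , y} e∈ = subst (_∈ crossings v) (pair-< x<y)
    (occursOddly⇒∈ (crossings v) (xor-cancelˡ (x <ᵇ y) (begin
      (x <ᵇ y) xor occursOddly (crossings v) (pair x y) ≡⟨ sym (⟦⟧-<ᵇ v x≢y) ⟩
      ⟦ v ⟧ x <ᵇ ⟦ v ⟧ y                               ≡⟨ cong₂ _<ᵇ_ (v≗w x) (v≗w y) ⟩
      ⟦ w ⟧ x <ᵇ ⟦ w ⟧ y                               ≡⟨ ⟦⟧-<ᵇ w x≢y ⟩
      (x <ᵇ y) xor occursOddly (crossings w) (pair x y) ≡⟨ cong ((x <ᵇ y) xor_) (occursOddly-unique u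
                                                          (subst (_∈ crossings w) (sym (pair-< x<y)) e∈)) ⟩
      (x <ᵇ y) xor true                                ∎)))
    where
    open ≡-Reasoning
    x<y : x < y
    x<y = All.lookup (crossings-ascending w) e∈
    x≢y : x ≢ y
    x≢y = ℤP.<⇒≢ x<y

same-length⇒reduced : ∀ {v w} → Reduced ⌊ w ⌋ → (∀ x → ⟦ v ⟧ x ≡ ⟦ w ⟧ x) →
  length v ≡ length w → Reduced ⌊ v ⌋
same-length⇒reduced {v} {w} red-w v≗w |v|≡|w| v' shorter v'≗v =
  red-w v' (subst (length v' ℕ.<_) (trans (length-⌊⌋ v) (trans |v|≡|w| (sym (length-⌊⌋ w)))) shorter)
    (λ x → trans (v'≗v x) (v≗w x))

τ-repeated : ∀ M u u' B → crossing (M ++ u' ∷ B) u ≡ crossing B u' → ∀ x → τ (M ++ B) u x ≡ τ B u' x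
τ-repeated M u u' B eq = t-unordered (begin
  pair (⟦ M ++ B ⟧⁻¹ u) (⟦ M ++ B ⟧⁻¹ (u + 1ℤ))
    ≡⟨ pair-transport {t α β} {t α β} (t-involutive α β)
         (trans (sym (cong₂ pair (⟦⟧⁻¹-insert M u' B u) (⟦⟧⁻¹-insert M u' B (u + 1ℤ)))) eq) ⟩
  pair (t α β α) (t α β β)  ≡⟨ cong₂ pair (t-a α β) (t-b α β) ⟩
  pair β α                  ≡⟨ pair-comm β α ⟩
  pair α β                  ∎)
  where
  open ≡-Reasoning
  α = ⟦ B ⟧⁻¹ u'
  β = ⟦ B ⟧⁻¹ (u' + 1ℤ)

module _ (A : List ℤ) (u : ℤ) (M : List ℤ) (u' : ℤ) (B : List ℤ)
         (repeated : crossing (M ++ u' ∷ B) u ≡ crossing B u') where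

  ⟦⟧-delete-repeated : ∀ x → ⟦ A ++ u ∷ M ++ u' ∷ B ⟧ x ≡ ⟦ A ++ M ++ B ⟧ x
  ⟦⟧-delete-repeated x = begin
    ⟦ A ++ u ∷ M ++ u' ∷ B ⟧ x        ≡⟨ cong (λ W → ⟦ W ⟧ x) (sym (LP.++-assoc A (u ∷ M) (u' ∷ B))) ⟩
    ⟦ (A ++ u ∷ M) ++ u' ∷ B ⟧ x      ≡⟨ ⟦⟧-insert (A ++ u ∷ M) u' B x ⟩
    ⟦ (A ++ u ∷ M) ++ B ⟧ (τ B u' x)  ≡⟨ cong (λ W → ⟦ W ⟧ (τ B u' x)) (LP.++-assoc A (u ∷ M) B) ⟩
    ⟦ A ++ u ∷ M ++ B ⟧ (τ B u' x)    ≡⟨ ⟦⟧-insert A u (M ++ B) (τ B u' x) ⟩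
    ⟦ A ++ M ++ B ⟧ (τ (M ++ B) u (τ B u' x)) ≡⟨ cong ⟦ A ++ M ++ B ⟧ (τ-repeated M u u' B repeated (τ B u' x)) ⟩
    ⟦ A ++ M ++ B ⟧ (τ B u' (τ B u' x)) ≡⟨ cong ⟦ A ++ M ++ B ⟧ (t-involutive (⟦ B ⟧⁻¹ u') (⟦ B ⟧⁻¹ (u' + 1ℤ)) x) ⟩
    ⟦ A ++ M ++ B ⟧ x                 ∎
    where open ≡-Reasoning

  ⟦⟧-move-repeated : ∀ x → ⟦ A ++ u ∷ M ++ B ⟧ x ≡ ⟦ A ++ M ++ u' ∷ B ⟧ x
  ⟦⟧-move-repeated x = begin
    ⟦ A ++ u ∷ M ++ B ⟧ x             ≡⟨ ⟦⟧-insert A u (M ++ B) x ⟩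
    ⟦ A ++ M ++ B ⟧ (τ (M ++ B) u x)  ≡⟨ cong ⟦ A ++ M ++ B ⟧ (τ-repeated M u u' B repeated x) ⟩
    ⟦ A ++ M ++ B ⟧ (τ B u' x)        ≡⟨ cong (λ W → ⟦ W ⟧ (τ B u' x)) (sym (LP.++-assoc A M B)) ⟩
    ⟦ (A ++ M) ++ B ⟧ (τ B u' x)      ≡⟨ sym (⟦⟧-insert (A ++ M) u' B x) ⟩
    ⟦ (A ++ M) ++ u' ∷ B ⟧ x          ≡⟨ cong (λ W → ⟦ W ⟧ x) (LP.++-assoc A M (u' ∷ B)) ⟩
    ⟦ A ++ M ++ u' ∷ B ⟧ x            ∎
    where open ≡-Reasoning

  repeated⇒¬reduced : ¬ Reduced ⌊ A ++ u ∷ M ++ u' ∷ B ⌋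
  repeated⇒¬reduced red = red (A ++ M ++ B) shorter (λ x → sym (⟦⟧-delete-repeated x))
    where
    open ≡-Reasoning
    L = length (A ++ M ++ B)
    |w|≡L+2 : length ⌊ A ++ u ∷ M ++ u' ∷ B ⌋ ≡ suc (suc L)
    |w|≡L+2 = begin
      length ⌊ A ++ u ∷ M ++ u' ∷ B ⌋       ≡⟨ length-⌊⌋ (A ++ u ∷ M ++ u' ∷ B) ⟩
      length (A ++ u ∷ M ++ u' ∷ B)         ≡⟨ LP.length-++-sucʳ A u (M ++ u' ∷ B) ⟩
      suc (length (A ++ M ++ u' ∷ B))       ≡⟨ cong (suc ∘ length) (sym (LP.++-assoc A M (u' ∷ B))) ⟩
      suc (length ((A ++ M) ++ u' ∷ B))     ≡⟨ cong suc (LP.length-++-sucʳ (A ++ M) u' B) ⟩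
      suc (suc (length ((A ++ M) ++ B)))    ≡⟨ cong (suc ∘ suc ∘ length) (LP.++-assoc A M B) ⟩
      suc (suc L)                           ∎
    shorter : L ℕ.< length ⌊ A ++ u ∷ M ++ u' ∷ B ⌋
    shorter = subst (L ℕ.<_) (sym |w|≡L+2) (ℕP.m<n⇒m<1+n (ℕP.n<1+n L))

reduced⇒unique : ∀ v → Reduced ⌊ v ⌋ → Unique (crossings v)
reduced⇒unique []      _   = []
reduced⇒unique (u ∷ v) red = AllP.¬Any⇒All¬ (crossings v) new ∷ reduced⇒unique v red-v
  where
  new : crossing v u ∉ crossings v
  new e∈ with ∈-crossings⁻ v e∈
  ... | M , u' , B , refl , eq = repeated⇒¬reduced [] u M u' B (sym eq) red
  red-v : Reduced ⌊ v ⌋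
  red-v v' shorter v'≗v = red (u ∷ v') (s≤s shorter) (cong (s u) ∘ v'≗v)

-- Inserting a letter into a reduced word

open import Data.List.Membership.DecPropositional _≟₂_ using (_∈?_)

crossings-transitive : ∀ v {x y z} → x < y → y < z → Unique (crossings v) →
  pair x y ∈ crossings v → pair y z ∈ crossings v → pair x z ∈ crossings v
crossings-transitive v {x} {y} {z} x<y y<z u xy∈ yz∈ with pair x z ∈? crossings v
... | yes xz∈ = xz∈
... | no xz∉  = ⊥-elim (ℤP.<-asym (⟦⟧-preserves v (ℤP.<-trans x<y y<z) xz∉)
                                   (ℤP.<-trans (⟦⟧-reverses v y<z u yz∈) (⟦⟧-reverses v x<y u xy∈)))

crossings-∷-unique : ∀ B m → ⟦ B ⟧⁻¹ m < ⟦ B ⟧⁻¹ (m + 1ℤ) → Unique (crossings B) →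
  Unique (crossings (m ∷ B))
crossings-∷-unique B m α<β u = AllP.¬Any⇒All¬ (crossings B) new ∷ u
  where
  new : crossing B m ∉ crossings B
  new αβ∈ = ℤP.<-asym (i<i+1 m)
    (subst₂ _<_ (⟦⟧-inverseʳ B (m + 1ℤ)) (⟦⟧-inverseʳ B m) (⟦⟧-reverses B α<β u αβ∈))

-- ⟦ B ⟧ γ compares alike with the adjacent m = ⟦ B ⟧ α and m + 1 = ⟦ B ⟧ β, so by ⟦⟧-<ᵇ
-- different parities force γ to compare differently with α and with β.
wire-between : ∀ B m {γ} → ⟦ B ⟧⁻¹ m < ⟦ B ⟧⁻¹ (m + 1ℤ) → γ ≢ ⟦ B ⟧⁻¹ m → γ ≢ ⟦ B ⟧⁻¹ (m + 1ℤ) →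
  occursOddly (crossings B) (pair (⟦ B ⟧⁻¹ m) γ) ≢ occursOddly (crossings B) (pair (⟦ B ⟧⁻¹ (m + 1ℤ)) γ) →
  ⟦ B ⟧⁻¹ m < γ × γ < ⟦ B ⟧⁻¹ (m + 1ℤ)
wire-between B m {γ} α<β γ≢α γ≢β parities≢ = separate (ℤP.<-cmp α γ)
  where
  α = ⟦ B ⟧⁻¹ m
  β = ⟦ B ⟧⁻¹ (m + 1ℤ)
  r = ⟦ B ⟧ γ
  r≢ : ∀ {k} → γ ≢ ⟦ B ⟧⁻¹ k → r ≢ k
  r≢ {k} γ≢ r≡k = γ≢ (trans (sym (⟦⟧-inverseˡ B γ)) (cong ⟦ B ⟧⁻¹ r≡k))
  order≢ : (α <ᵇ γ) ≢ (β <ᵇ γ)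
  order≢ = xor-differs (α <ᵇ γ) (β <ᵇ γ) (begin
    (α <ᵇ γ) xor occursOddly (crossings B) (pair α γ)  ≡⟨ sym (⟦⟧-<ᵇ B (γ≢α ∘ sym)) ⟩
    ⟦ B ⟧ α <ᵇ r                                        ≡⟨ cong (_<ᵇ r) (⟦⟧-inverseʳ B m) ⟩
    m <ᵇ r                                              ≡⟨ <ᵇ-adjacent m (r≢ γ≢β) ⟩
    (m + 1ℤ) <ᵇ r                                       ≡⟨ cong (_<ᵇ r) (sym (⟦⟧-inverseʳ B (m + 1ℤ))) ⟩
    ⟦ B ⟧ β <ᵇ r                                        ≡⟨ ⟦⟧-<ᵇ B (γ≢β ∘ sym) ⟩
    (β <ᵇ γ) xor occursOddly (crossings B) (pair β γ)  ∎) parities≢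
    where open ≡-Reasoning
  separate : Tri (α < γ) (α ≡ γ) (γ < α) → α < γ × γ < β
  separate (tri< α<γ _ _) = α<γ , ℤP.≤∧≢⇒< (ℤP.≮⇒≥ β≮γ) γ≢β
    where
    β≮γ : ¬ β < γ
    β≮γ β<γ = order≢ (trans (dec-true (α ℤ.<? γ) α<γ) (sym (dec-true (β ℤ.<? γ) β<γ)))
  separate (tri≈ _ α≡γ _) = ⊥-elim (γ≢α (sym α≡γ))
  separate (tri> _ _ γ<α) = ⊥-elim (order≢ (trans (dec-false (α ℤ.<? γ) (ℤP.<-asym γ<α))
    (sym (dec-false (β ℤ.<? γ) (ℤP.<-asym (ℤP.<-trans γ<α α<β))))))

map-t-pair-unique : ∀ a b {xs} → All Ascending xs → Unique xs → Unique (map (t-pair a b) xs)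
map-t-pair-unique a b []          []         = []
map-t-pair-unique a b (x↑ ∷ xs↑) (x∉ ∷ u) =
  AllP.map⁺ (All.zipWith (λ (y↑ , x≢y) → x≢y ∘ t-pair-injective a b x↑ y↑) (xs↑ , x∉))
  ∷ map-t-pair-unique a b xs↑ u

t-pair-fix : ∀ a b → t-pair a b (pair a b) ≡ pair a b
t-pair-fix a b = trans (t-pair-pair a b a b) (trans (cong₂ pair (t-a a b) (t-b a b)) (pair-comm b a))

module Insertion (A B : List ℤ) (m : ℤ) (α<β : ⟦ B ⟧⁻¹ m < ⟦ B ⟧⁻¹ (m + 1ℤ))
                 (U : Unique (crossings (A ++ B))) where

  α β : ℤ
  α = ⟦ B ⟧⁻¹ m
  β = ⟦ B ⟧⁻¹ (m + 1ℤ)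

  private
    U-split : Unique (prefixCrossings A B ++ crossings B)
    U-split = subst Unique (crossings-++ A B) U

    U-B : Unique (crossings B)
    U-B = Unique-++⁻ʳ (prefixCrossings A B) U-split

    A∩B=∅ : Disjoint (prefixCrossings A B) (crossings B)
    A∩B=∅ = Unique-++⇒Disjoint (prefixCrossings A B) U-split

    ∈-A++B : ∀ {e} → e ∈ prefixCrossings A B ⊎ e ∈ crossings B → e ∈ crossings (A ++ B)
    ∈-A++B (inj₁ e∈) = subst (_ ∈_) (sym (crossings-++ A B)) (MP.∈-++⁺ˡ e∈)
    ∈-A++B (inj₂ e∈) = subst (_ ∈_) (sym (crossings-++ A B)) (MP.∈-++⁺ʳ (prefixCrossings A B) e∈)

    shifted : ∀ {e} → e ∈ prefixCrossings A B → t-pair α β e ∈ prefixCrossings A (m ∷ B)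
    shifted {e} e∈ = subst (t-pair α β e ∈_) (sym (prefixCrossings-insert A m B)) (MP.∈-map⁺ (t-pair α β) e∈)

  shifted-unique : Unique (prefixCrossings A (m ∷ B))
  shifted-unique = subst Unique (sym (prefixCrossings-insert A m B))
    (map-t-pair-unique α β (prefixCrossings-ascending A B) (Unique-++⁻ˡ (prefixCrossings A B) U-split))

  module _ (αβ∉ : pair α β ∉ prefixCrossings A (m ∷ B)) where

    private
      αβ∉A++B : pair α β ∉ crossings (A ++ B)
      αβ∉A++B αβ∈ with MP.∈-++⁻ (prefixCrossings A B) (subst (_ ∈_) (crossings-++ A B) αβ∈)
      ... | inj₁ αβ∈A = αβ∉ (subst (_∈ prefixCrossings A (m ∷ B)) (t-pair-fix α β) (shifted αβ∈A))
      ... | inj₂ αβ∈B = UniqueP.Unique[x∷xs]⇒x∉xs (crossings-∷-unique B m α<β U-B) αβ∈B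

      differently-crossed : ∀ {δ ε γ} → pair δ γ ∈ prefixCrossings A B → pair ε γ ∈ crossings B →
        occursOddly (crossings B) (pair δ γ) ≢ occursOddly (crossings B) (pair ε γ)
      differently-crossed {δ} {ε} {γ} δγ∈A εγ∈B eq = false≢true (begin
        false                                   ≡⟨ sym (occursOddly-∉ (crossings B) (λ δγ∈B → A∩B=∅ (δγ∈A , δγ∈B))) ⟩
        occursOddly (crossings B) (pair δ γ)    ≡⟨ eq ⟩
        occursOddly (crossings B) (pair ε γ)    ≡⟨ occursOddly-unique U-B εγ∈B ⟩
        true                                    ∎)
        where open ≡-Reasoning

      -- γ lies between α and β, so A ++ B, crossing γ with both, crosses α and β by transitivity.
      separated-wire : ∀ {γ} → γ ≢ α → γ ≢ β →
        occursOddly (crossings B) (pair α γ) ≢ occursOddly (crossings B) (pair β γ) →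
        pair α γ ∈ crossings (A ++ B) → pair β γ ∈ crossings (A ++ B) → ⊥
      separated-wire {γ} γ≢α γ≢β parities≢ αγ∈ βγ∈ =
        let α<γ , γ<β = wire-between B m α<β γ≢α γ≢β parities≢ in
        αβ∉A++B (crossings-transitive (A ++ B) α<γ γ<β U αγ∈ (subst (_∈ _) (pair-comm β γ) βγ∈))

      crossed-on-both-sides : ∀ {γ} → γ ≢ α → γ ≢ β →
        (pair α γ ∈ prefixCrossings A B × pair β γ ∈ crossings B) ⊎
        (pair β γ ∈ prefixCrossings A B × pair α γ ∈ crossings B) → ⊥
      crossed-on-both-sides γ≢α γ≢β (inj₁ (αγ∈A , βγ∈B)) = separated-wire γ≢α γ≢β
        (differently-crossed αγ∈A βγ∈B) (∈-A++B (inj₁ αγ∈A)) (∈-A++B (inj₂ βγ∈B))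
      crossed-on-both-sides γ≢α γ≢β (inj₂ (βγ∈A , αγ∈B)) = separated-wire γ≢α γ≢β
        (differently-crossed βγ∈A αγ∈B ∘ sym) (∈-A++B (inj₂ αγ∈B)) (∈-A++B (inj₁ βγ∈A))

      shifted-∉-B : ∀ {x y} → x < y → TranspositionView α β x → TranspositionView α β y →
        (x , y) ∈ prefixCrossings A B → t-pair α β (x , y) ∉ crossings B
      shifted-∉-B {x} {y} x<y (at-a refl) (at-a refl) _ _ = ℤP.<-irrefl refl x<y
      shifted-∉-B {x} {y} x<y (at-a refl) (at-b _ refl) αβ∈A _ =
        αβ∉ (subst (_∈ prefixCrossings A (m ∷ B)) (trans (cong (t-pair α β) (sym (pair-< α<β))) (t-pair-fix α β)) (shifted αβ∈A))
      shifted-∉-B {x} {y} x<y (at-a refl) (fixed y≢α y≢β) αy∈A e∈B = crossed-on-both-sides y≢α y≢β (inj₁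
        (subst (_∈ _) (sym (pair-< x<y)) αy∈A , subst (_∈ _) (cong₂ pair (t-a α β) (t-fix y≢α y≢β)) e∈B))
      shifted-∉-B {x} {y} x<y (at-b _ refl) (at-a refl) _ _ = ℤP.<-asym x<y α<β
      shifted-∉-B {x} {y} x<y (at-b _ refl) (at-b _ refl) _ _ = ℤP.<-irrefl refl x<y
      shifted-∉-B {x} {y} x<y (at-b _ refl) (fixed y≢α y≢β) βy∈A e∈B = crossed-on-both-sides y≢α y≢β (inj₂
        (subst (_∈ _) (sym (pair-< x<y)) βy∈A , subst (_∈ _) (cong₂ pair (t-b α β) (t-fix y≢α y≢β)) e∈B))
      shifted-∉-B {x} {y} x<y (fixed x≢α x≢β) (at-a refl) xα∈A e∈B = crossed-on-both-sides x≢α x≢β (inj₁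
        (subst (_∈ _) (trans (sym (pair-< x<y)) (pair-comm x α)) xα∈A ,
         subst (_∈ _) (trans (cong₂ pair (t-fix x≢α x≢β) (t-a α β)) (pair-comm x β)) e∈B))
      shifted-∉-B {x} {y} x<y (fixed x≢α x≢β) (at-b _ refl) xβ∈A e∈B = crossed-on-both-sides x≢α x≢β (inj₂
        (subst (_∈ _) (trans (sym (pair-< x<y)) (pair-comm x β)) xβ∈A ,
         subst (_∈ _) (trans (cong₂ pair (t-fix x≢α x≢β) (t-b α β)) (pair-comm x α)) e∈B))
      shifted-∉-B {x} {y} x<y (fixed x≢α x≢β) (fixed y≢α y≢β) xy∈A e∈B =
        A∩B=∅ (xy∈A , subst (_∈ _) (trans (cong₂ pair (t-fix x≢α x≢β) (t-fix y≢α y≢β)) (pair-< x<y)) e∈B)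

      shifted-disjoint : Disjoint (prefixCrossings A (m ∷ B)) (crossings B)
      shifted-disjoint (e∈A' , e∈B)
        with MP.∈-map⁻ (t-pair α β) (subst (_ ∈_) (prefixCrossings-insert A m B) e∈A')
      ... | (x , y) , xy∈A , refl = shifted-∉-B (All.lookup (prefixCrossings-ascending A B) xy∈A)
        (transpositionView α β x) (transpositionView α β y) xy∈A e∈B

    insert-unique : Unique (crossings (A ++ m ∷ B))
    insert-unique = subst Unique (sym (crossings-++ A (m ∷ B)))
      (UniqueP.++⁺ shifted-unique (crossings-∷-unique B m α<β U-B) disjoint)
      where
      disjoint : Disjoint (prefixCrossings A (m ∷ B)) (crossings (m ∷ B))
      disjoint (e∈A' , here refl)  = αβ∉ e∈A'
      disjoint (e∈A' , there e∈B) = shifted-disjoint (e∈A' , e∈B)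

-- Deleting a letter

crossing-descends : ∀ R u → Unique (crossings R) → crossing R u ∈ crossings R →
  ⟦ R ⟧⁻¹ (u + 1ℤ) < ⟦ R ⟧⁻¹ u
crossing-descends R u U crossed with ℤP.<-cmp (⟦ R ⟧⁻¹ u) (⟦ R ⟧⁻¹ (u + 1ℤ))
... | tri< x<y _ _ = ⊥-elim (ℤP.<-asym (i<i+1 u)
        (subst₂ _<_ (⟦⟧-inverseʳ R (u + 1ℤ)) (⟦⟧-inverseʳ R u) (⟦⟧-reverses R x<y U crossed)))
... | tri≈ _ x≡y _ = ⊥-elim (i≢i+1 u (⟦⟧⁻¹-injective R x≡y))
... | tri> _ _ y<x = y<x

repeated-crossing-descends : ∀ A₂ c m B → ⟦ B ⟧⁻¹ m < ⟦ B ⟧⁻¹ (m + 1ℤ) →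
  crossing (A₂ ++ m ∷ B) c ≡ crossing B m → Unique (crossings (A₂ ++ m ∷ B)) →
  ⟦ A₂ ++ m ∷ B ⟧⁻¹ c ≡ ⟦ B ⟧⁻¹ (m + 1ℤ)
repeated-crossing-descends A₂ c m B α<β repeated U with pair-injective repeated
... | inj₂ (c↦β , _) = c↦β
... | inj₁ (c↦α , c+1↦β) = ⊥-elim (ℤP.<-asym α<β
        (subst₂ _<_ c+1↦β c↦α (crossing-descends (A₂ ++ m ∷ B) c U (subst (_∈ crossings (A₂ ++ m ∷ B)) (sym repeated) αβ∈))))
  where
  αβ∈ : crossing B m ∈ crossings (A₂ ++ m ∷ B)
  αβ∈ = subst (crossing B m ∈_) (sym (crossings-++ A₂ (m ∷ B))) (MP.∈-++⁺ʳ (prefixCrossings A₂ (m ∷ B)) (here refl))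

at-middle : ∀ A (c : ℤ∞) Y → (⌊ A ⌋ ++ c ∷ Y) at suc (length A) ≡ c
at-middle []          c Y = refl
at-middle (_ ∷ [])    c Y = refl
at-middle (_ ∷ a ∷ A) c Y = at-middle (a ∷ A) c Y

setAt-middle : ∀ A (c : ℤ∞) B x → setAt (⌊ A ⌋ ++ c ∷ ⌊ B ⌋) (suc (length A)) (fin x) ≡ ⌊ A ++ x ∷ B ⌋
setAt-middle []          c B x = refl
setAt-middle (_ ∷ [])    c B x = refl
setAt-middle (a ∷ a' ∷ A) c B x = cong (fin a ∷_) (setAt-middle (a' ∷ A) c B x)

deleteAt-middle : ∀ A d B → deleteAt ⌊ A ++ d ∷ B ⌋ (suc (length A)) ≡ ⌊ A ++ B ⌋
deleteAt-middle []          d B = refl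
deleteAt-middle (_ ∷ [])    d B = refl
deleteAt-middle (a ∷ a' ∷ A) d B = cong (fin a ∷_) (deleteAt-middle (a' ∷ A) d B)

ℓ-middle : ∀ A (c : ℤ∞) B k → ℓ (⌊ A ⌋ ++ c ∷ ⌊ B ⌋) (suc (length A)) k ≡ ⟦ B ⟧⁻¹ k
ℓ-middle []      c B k = refl
ℓ-middle (_ ∷ A) c B k = ℓ-middle A c B k

split-at : ∀ (X : List ℤ) q → q ℕ.< length X →
  Σ (List ℤ) λ X₀ → Σ ℤ λ d → Σ (List ℤ) λ X₁ → X ≡ X₀ ++ d ∷ X₁ × length X₀ ≡ q
split-at (x ∷ X) zero    _        = [] , x , X , refl , refl
split-at (x ∷ X) (suc q) (s≤s q<) with split-at X q q<
... | X₀ , d , X₁ , refl , refl = x ∷ X₀ , d , X₁ , refl , refl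

-- Deleting c restores a reduced word; deleting any earlier letter keeps both copies of the crossing.
leftmost-deletion : ∀ A₁ c A₂ m B → crossing (A₂ ++ m ∷ B) c ≡ crossing B m →
  Reduced ⌊ A₁ ++ A₂ ++ m ∷ B ⌋ → LeftmostDel (⌊ A₁ ⌋ ++ fin c ∷ ⌊ A₂ ++ m ∷ B ⌋) (suc (length A₁))
leftmost-deletion A₁ c A₂ m B repeated reduced =
  s≤s z≤n , within , subst Reduced (sym deleted) reduced , earlier
  where
  R = A₂ ++ m ∷ B
  as-⌊⌋ : ⌊ A₁ ⌋ ++ fin c ∷ ⌊ R ⌋ ≡ ⌊ A₁ ++ c ∷ R ⌋
  as-⌊⌋ = sym (LP.map-++ fin A₁ (c ∷ R))
  within : suc (length A₁) ℕ.≤ length (⌊ A₁ ⌋ ++ fin c ∷ ⌊ R ⌋)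
  within = subst (λ n → suc n ℕ.≤ length (⌊ A₁ ⌋ ++ fin c ∷ ⌊ R ⌋)) (length-⌊⌋ A₁) (length-<-++-∷ ⌊ A₁ ⌋ (fin c) ⌊ R ⌋)
  deleted : deleteAt (⌊ A₁ ⌋ ++ fin c ∷ ⌊ R ⌋) (suc (length A₁)) ≡ ⌊ A₁ ++ R ⌋
  deleted = trans (cong (λ W → deleteAt W (suc (length A₁))) as-⌊⌋) (deleteAt-middle A₁ c R)
  earlier : ∀ q → 1 ℕ.≤ q → q ℕ.< suc (length A₁) → ¬ Reduced (deleteAt (⌊ A₁ ⌋ ++ fin c ∷ ⌊ R ⌋) q)
  earlier (suc q) _ (s≤s q<) with split-at A₁ q q<
  ... | A₀ , d , A₀' , refl , refl = subst (¬_ ∘ Reduced) (sym without-d)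
                                        (repeated⇒¬reduced (A₀ ++ A₀') c A₂ m B repeated)
    where
    without-d : deleteAt (⌊ A₀ ++ d ∷ A₀' ⌋ ++ fin c ∷ ⌊ R ⌋) (suc (length A₀)) ≡ ⌊ (A₀ ++ A₀') ++ c ∷ R ⌋
    without-d = begin
      deleteAt (⌊ A₀ ++ d ∷ A₀' ⌋ ++ fin c ∷ ⌊ R ⌋) (suc (length A₀))
        ≡⟨ cong (λ W → deleteAt W (suc (length A₀))) (trans as-⌊⌋ (cong ⌊_⌋ (LP.++-assoc A₀ (d ∷ A₀') (c ∷ R)))) ⟩
      deleteAt ⌊ A₀ ++ d ∷ A₀' ++ c ∷ R ⌋ (suc (length A₀))
        ≡⟨ deleteAt-middle A₀ d (A₀' ++ c ∷ R) ⟩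
      ⌊ A₀ ++ A₀' ++ c ∷ R ⌋
        ≡⟨ cong ⌊_⌋ (sym (LP.++-assoc A₀ A₀' (c ∷ R))) ⟩
      ⌊ (A₀ ++ A₀') ++ c ∷ R ⌋ ∎
      where open ≡-Reasoning

-- The Monk maximum

-- MonkCond i w j is Straddle (ℓ w j) i.
Straddle : (ℤ → ℤ) → ℤ → ℤ → Set
Straddle σ i k = σ k ≤ i × i < σ (k + 1ℤ)

straddle? : ∀ σ i → Decidable (Straddle σ i)
straddle? σ i k = (σ k ℤ.≤? i) ×-dec (i ℤ.<? σ (k + 1ℤ))

<∞? : ∀ k c → Dec (k <∞ c)
<∞? k (fin n) = k ℤ.<? n
<∞? k ∞       = yes tt

≤⇒≡+ : ∀ {lo hi} → lo ≤ hi → Σ ℕ λ n → lo + + n ≡ hi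
≤⇒≡+ {lo} {hi} lo≤hi = ℤ.∣ hi - lo ∣ , (begin
  lo + + ℤ.∣ hi - lo ∣  ≡⟨ cong (λ z → lo + z) (ℤP.0≤i⇒+∣i∣≡i (ℤP.i≤j⇒0≤j-i lo≤hi)) ⟩
  lo + (hi - lo)       ≡⟨ x+[y-x]≡y lo hi ⟩
  hi                   ∎)
  where
  open ≡-Reasoning
  x+[y-x]≡y : ∀ (x y : ℤ) → x + (y - x) ≡ y
  x+[y-x]≡y = solve-∀

+-suc : ∀ x n → x + + suc n ≡ (x + + n) + 1ℤ
+-suc x n = trans (cong (λ k → x + + k) (ℕP.+-comm 1 n)) (sym (ℤP.+-assoc x (+ n) 1ℤ))

straddle-exists : ∀ σ i {lo hi} → lo ≤ hi → σ lo ≤ i → i < σ hi → Σ ℤ λ k → k < hi × Straddle σ i k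
straddle-exists σ i {lo} lo≤hi σlo≤i i<σhi with ≤⇒≡+ lo≤hi
... | n , refl = search lo n σlo≤i i<σhi
  where
  search : ∀ x n → σ x ≤ i → i < σ (x + + n) → Σ ℤ λ k → k < x + + n × Straddle σ i k
  search x zero σx≤i i<σx = ⊥-elim (ℤP.<-irrefl refl
    (ℤP.≤-<-trans σx≤i (subst (λ z → i < σ z) (ℤP.+-identityʳ x) i<σx)))
  search x (suc n) σx≤i i<σ with σ (x + 1ℤ) ℤ.≤? i
  ... | no σ[x+1]≰i = x , x<x+sn , σx≤i , ℤP.≰⇒> σ[x+1]≰i
    where
    x<x+sn : x < x + + suc n
    x<x+sn = subst (x <_) (sym (+-suc x n)) (ℤP.≤-<-trans (ℤP.i≤i+j x (+ n)) (i<i+1 (x + + n)))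
  ... | yes σ[x+1]≤i =
    let k , k< , straddles = search (x + 1ℤ) n σ[x+1]≤i (subst (λ z → i < σ z) (sym (ℤP.+-assoc x 1ℤ (+ n))) i<σ)
    in k , subst (k <_) (ℤP.+-assoc x 1ℤ (+ n)) k< , straddles

bounded-max : ∀ {P : ℤ → Set} → Decidable P → ∀ {k₀ u} → P k₀ → (∀ {k} → P k → k < u) →
  Σ ℤ λ m → P m × (∀ {k} → P k → k ≤ m)
bounded-max {P} P? {k₀} Pk₀ bounded with ≤⇒≡+ (<⇒+1≤ (bounded Pk₀))
... | n , refl = search n bounded
  where
  search : ∀ n → (∀ {k} → P k → k < (k₀ + 1ℤ) + + n) → Σ ℤ λ m → P m × (∀ {k} → P k → k ≤ m)
  search zero    below = k₀ , Pk₀ , λ Pk → <+1⇒≤ (subst (_ <_) (ℤP.+-identityʳ _) (below Pk))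
  search (suc n) below with P? ((k₀ + 1ℤ) + + n)
  ... | yes Ptop = _ , Ptop , λ Pk → <+1⇒≤ (subst (_ <_) (+-suc (k₀ + 1ℤ) n) (below Pk))
  ... | no ¬Ptop = search n λ Pk → ℤP.≤∧≢⇒< (<+1⇒≤ (subst (_ <_) (+-suc (k₀ + 1ℤ) n) (below Pk)))
                                            (λ k≡top → ¬Ptop (subst P k≡top Pk))

s-fixes-above : ∀ u {k} → (u + 1ℤ) + 1ℤ ≤ k → s u k ≡ k
s-fixes-above u {k} u+2≤k = t-fix (λ k≡u → ℤP.<-asym (i<i+1 u) (subst (u + 1ℤ <_) k≡u u+1<k))
                                  (λ k≡u+1 → ℤP.<-irrefl (sym k≡u+1) u+1<k)
  where
  u+1<k : u + 1ℤ < k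
  u+1<k = ℤP.<-≤-trans (i<i+1 (u + 1ℤ)) u+2≤k

s-fixes-below : ∀ u {k} → k < u → s u k ≡ k
s-fixes-below u {k} k<u = t-fix (λ k≡u → ℤP.<-irrefl k≡u k<u)
                                (λ k≡u+1 → ℤP.<-irrefl k≡u+1 (ℤP.<-trans k<u (i<i+1 u)))

⟦⟧⁻¹-fixes-above : ∀ B → Σ ℤ λ h → ∀ {k} → h ≤ k → ⟦ B ⟧⁻¹ k ≡ k
⟦⟧⁻¹-fixes-above []      = 0ℤ , λ _ → refl
⟦⟧⁻¹-fixes-above (u ∷ B) with ⟦⟧⁻¹-fixes-above B
... | h , fixes = ((u + 1ℤ) + 1ℤ) ⊔ h , λ bound≤k →
  trans (cong ⟦ B ⟧⁻¹ (s-fixes-above u (ℤP.i⊔j≤k⇒i≤k _ h bound≤k))) (fixes (ℤP.i⊔j≤k⇒j≤k _ h bound≤k))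

⟦⟧⁻¹-fixes-below : ∀ B → Σ ℤ λ l → ∀ {k} → k ≤ l → ⟦ B ⟧⁻¹ k ≡ k
⟦⟧⁻¹-fixes-below []      = 0ℤ , λ _ → refl
⟦⟧⁻¹-fixes-below (u ∷ B) with ⟦⟧⁻¹-fixes-below B
... | l , fixes = ℤ.pred u ⊓ l , λ k≤bound →
  trans (cong ⟦ B ⟧⁻¹ (s-fixes-below u (ℤP.i≤pred[j]⇒i<j (ℤP.i≤j⊓k⇒i≤j _ l k≤bound))))
        (fixes (ℤP.i≤j⊓k⇒i≤k _ l k≤bound))

straddle-below : ∀ B i c → i < ⟦ B ⟧⁻¹ c → Σ ℤ λ k → k < c × Straddle ⟦ B ⟧⁻¹ i k
straddle-below B i c i<σc with ⟦⟧⁻¹-fixes-below B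
... | l , fixes with (l ⊓ i) ℤ.≤? c
...   | yes lo≤c = straddle-exists ⟦ B ⟧⁻¹ i lo≤c
                     (subst (_≤ i) (sym (fixes (ℤP.i⊓j≤i l i))) (ℤP.i⊓j≤j l i)) i<σc
...   | no lo≰c = ⊥-elim (ℤP.<-irrefl refl (ℤP.<-≤-trans i<σc
                     (subst (_≤ i) (sym (fixes c≤l)) (ℤP.<⇒≤ (ℤP.<-≤-trans c<lo (ℤP.i⊓j≤j l i))))))
  where
  c<lo = ℤP.≰⇒> lo≰c
  c≤l = ℤP.<⇒≤ (ℤP.<-≤-trans c<lo (ℤP.i⊓j≤i l i))

straddle-cong : ∀ {σ σ' i k} → (∀ k → σ k ≡ σ' k) → Straddle σ i k → Straddle σ' i k
straddle-cong {i = i} {k} σ≗σ' (σk≤i , i<σ[k+1]) =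
  subst (_≤ i) (σ≗σ' k) σk≤i , subst (i <_) (σ≗σ' (k + 1ℤ)) i<σ[k+1]

straddles-bounded : ∀ i B c → Σ ℤ λ u → ∀ {k} → k <∞ c → Straddle ⟦ B ⟧⁻¹ i k → k < u
straddles-bounded i B (fin n) = n , λ k<n _ → k<n
straddles-bounded i B ∞ with ⟦⟧⁻¹-fixes-above B
... | h , fixes = h ⊔ (i + 1ℤ) , λ _ (σk≤i , _) → ℤP.≰⇒> λ u≤k →
  ℤP.<-irrefl refl (ℤP.<-≤-trans (i<i+1 i)
    (ℤP.≤-trans (ℤP.i⊔j≤k⇒j≤k h _ u≤k) (subst (_≤ i) (fixes (ℤP.i⊔j≤k⇒i≤k h _ u≤k)) σk≤i)))

-- The set maximised by a Monk step at a letter c followed by B is nonempty.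
Pending : ℤ → ℤ∞ → List ℤ → Set
Pending i c B = Σ ℤ λ k → k <∞ c × Straddle ⟦ B ⟧⁻¹ i k

pending-∞ : ∀ i B → Pending i ∞ B
pending-∞ i B with ⟦⟧⁻¹-fixes-above B
... | h , fixes with straddle-below B i (h ⊔ (i + 1ℤ))
                       (subst (i <_) (sym (fixes (ℤP.i≤i⊔j h _))) (ℤP.<-≤-trans (i<i+1 i) (ℤP.i≤j⊔i h _)))
...   | k , _ , straddles = k , tt , straddles

monk-max : ∀ i A c B → Pending i c B →
  Σ ℤ λ m → IsMonkMax i (⌊ A ⌋ ++ c ∷ ⌊ B ⌋) (suc (length A)) m × Straddle ⟦ B ⟧⁻¹ i m
monk-max i A c B (k₀ , k₀<c , k₀-straddles)
  with bounded-max P? (k₀<c , straddle-cong (sym ∘ ℓ-middle A c B) k₀-straddles) bounded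
  where
  σ = ℓ (⌊ A ⌋ ++ c ∷ ⌊ B ⌋) (suc (length A))
  P : ℤ → Set
  P k = k <∞ c × Straddle σ i k
  P? : Decidable P
  P? k = <∞? k c ×-dec straddle? σ i k
  bounded : ∀ {k} → P k → k < proj₁ (straddles-bounded i B c)
  bounded (k<c , straddles) = proj₂ (straddles-bounded i B c) k<c (straddle-cong (ℓ-middle A c B) straddles)
... | m , (m<c , m-straddles) , maximal =
  m , (c , at-middle A c ⌊ B ⌋ , m<c , m-straddles , λ _ k<c k-straddles → maximal (k<c , k-straddles)) ,
  straddle-cong (ℓ-middle A c B) m-straddles

-- Running Monk insertion

module Run (π : ℤ → ℤ) (i : ℤ) (a : List ℤ) (a≗π : ∀ x → ⟦ a ⟧ x ≡ π x) (a-reduced : Reduced ⌊ a ⌋) where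

  MinimalWord : List ℤ → Set
  MinimalWord v = (∀ x → ⟦ v ⟧ x ≡ π x) × length v ≡ length a

  minimal⇒reduced : ∀ {v} → MinimalWord v → Reduced ⌊ v ⌋
  minimal⇒reduced {v} (v≗π , |v|≡|a|) = same-length⇒reduced {v} {a} a-reduced (λ x → trans (v≗π x) (sym (a≗π x))) |v|≡|a|

  Terminates : Word → ℕ → Set
  Terminates w j = Σ Word λ out → MonkRun i w j out ×
    Σ ℤ λ α → Σ ℤ λ β → α ≤ i × i < β × (∀ x → perm out x ≡ π (t α β x))

  stop-here : ∀ A c B m → IsMonkMax i (⌊ A ⌋ ++ c ∷ ⌊ B ⌋) (suc (length A)) m → Straddle ⟦ B ⟧⁻¹ i m →
    MinimalWord (A ++ B) → crossing B m ∉ prefixCrossings A (m ∷ B) →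
    Terminates (⌊ A ⌋ ++ c ∷ ⌊ B ⌋) (suc (length A))
  stop-here A c B m max (α≤i , i<β) minimal new =
    setAt (⌊ A ⌋ ++ c ∷ ⌊ B ⌋) (suc (length A)) (fin m) ,
    stop max (subst Reduced (sym (setAt-middle A c B m)) (unique⇒reduced (A ++ m ∷ B) inserted-unique)) ,
    ⟦ B ⟧⁻¹ m , ⟦ B ⟧⁻¹ (m + 1ℤ) , α≤i , i<β ,
    λ x → subst (λ W → perm W x ≡ π (τ B m x)) (sym (setAt-middle A c B m))
                (trans (⟦⟧-insert A m B x) (proj₁ minimal (τ B m x)))
    where
    inserted-unique : Unique (crossings (A ++ m ∷ B))
    inserted-unique = Insertion.insert-unique A B m (ℤP.≤-<-trans α≤i i<β)
      (reduced⇒unique (A ++ B) (minimal⇒reduced {A ++ B} minimal)) new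

  module _ (A₁ : List ℤ) (c' : ℤ) (A₂ B : List ℤ) (m : ℤ)
           (repeated : crossing (A₂ ++ m ∷ B) c' ≡ crossing B m) where

    deletion-minimal : MinimalWord ((A₁ ++ c' ∷ A₂) ++ B) → MinimalWord (A₁ ++ A₂ ++ m ∷ B)
    deletion-minimal (≗π , |A++B|≡|a|) = (λ x → begin
      ⟦ A₁ ++ A₂ ++ m ∷ B ⟧ x     ≡⟨ sym (⟦⟧-move-repeated A₁ c' A₂ m B repeated x) ⟩
      ⟦ A₁ ++ c' ∷ A₂ ++ B ⟧ x    ≡⟨ cong (λ W → ⟦ W ⟧ x) (sym (LP.++-assoc A₁ (c' ∷ A₂) B)) ⟩
      ⟦ (A₁ ++ c' ∷ A₂) ++ B ⟧ x  ≡⟨ ≗π x ⟩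
      π x                         ∎) , (begin
      length (A₁ ++ A₂ ++ m ∷ B)              ≡⟨ LP.length-++ A₁ ⟩
      length A₁ ℕ.+ length (A₂ ++ m ∷ B)      ≡⟨ cong (length A₁ ℕ.+_) (LP.length-++-sucʳ A₂ m B) ⟩
      length A₁ ℕ.+ suc (length (A₂ ++ B))    ≡⟨ sym (LP.length-++ A₁) ⟩
      length (A₁ ++ c' ∷ A₂ ++ B)             ≡⟨ cong length (sym (LP.++-assoc A₁ (c' ∷ A₂) B)) ⟩
      length ((A₁ ++ c' ∷ A₂) ++ B)           ≡⟨ |A++B|≡|a| ⟩
      length a                                ∎)
      where open ≡-Reasoning

    deletion-pending : Straddle ⟦ B ⟧⁻¹ i m → MinimalWord (A₁ ++ A₂ ++ m ∷ B) → Pending i (fin c') (A₂ ++ m ∷ B)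
    deletion-pending (α≤i , i<β) minimal = straddle-below (A₂ ++ m ∷ B) i c'
      (subst (i <_) (sym (repeated-crossing-descends A₂ c' m B (ℤP.≤-<-trans α≤i i<β) repeated
        (crossings-suffix-unique A₁ (reduced⇒unique (A₁ ++ A₂ ++ m ∷ B) (minimal⇒reduced {A₁ ++ A₂ ++ m ∷ B} minimal))))) i<β)

    continue-with : ∀ c → IsMonkMax i (⌊ A₁ ++ c' ∷ A₂ ⌋ ++ c ∷ ⌊ B ⌋) (suc (length (A₁ ++ c' ∷ A₂))) m →
      MinimalWord (A₁ ++ A₂ ++ m ∷ B) →
      Terminates (⌊ A₁ ⌋ ++ fin c' ∷ ⌊ A₂ ++ m ∷ B ⌋) (suc (length A₁)) →
      Terminates (⌊ A₁ ++ c' ∷ A₂ ⌋ ++ c ∷ ⌊ B ⌋) (suc (length (A₁ ++ c' ∷ A₂)))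
    continue-with c max minimal (out , steps , product) =
      out , next max (subst (¬_ ∘ Reduced) (sym new-word) (repeated⇒¬reduced A₁ c' A₂ m B repeated))
                     (subst (λ W → LeftmostDel W (suc (length A₁))) (sym new-word')
                            (leftmost-deletion A₁ c' A₂ m B repeated (minimal⇒reduced {A₁ ++ A₂ ++ m ∷ B} minimal)))
                     (subst (λ W → MonkRun i W (suc (length A₁)) out) (sym new-word') steps) ,
      product
      where
      A = A₁ ++ c' ∷ A₂
      new-word : setAt (⌊ A ⌋ ++ c ∷ ⌊ B ⌋) (suc (length A)) (fin m) ≡ ⌊ A₁ ++ c' ∷ A₂ ++ m ∷ B ⌋
      new-word = trans (setAt-middle A c B m) (cong ⌊_⌋ (LP.++-assoc A₁ (c' ∷ A₂) (m ∷ B)))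
      new-word' : setAt (⌊ A ⌋ ++ c ∷ ⌊ B ⌋) (suc (length A)) (fin m) ≡ ⌊ A₁ ⌋ ++ fin c' ∷ ⌊ A₂ ++ m ∷ B ⌋
      new-word' = trans new-word (LP.map-++ fin A₁ (c' ∷ A₂ ++ m ∷ B))

  -- Each step either stops or resumes strictly to the left, so length A bounds the number of steps.
  run : ∀ n A c B → length A ℕ.< n → MinimalWord (A ++ B) → Pending i c B →
    Terminates (⌊ A ⌋ ++ c ∷ ⌊ B ⌋) (suc (length A))
  run (suc n) A c B |A|<n minimal pending with monk-max i A c B pending
  ... | m , max , straddles with crossing B m ∈? prefixCrossings A (m ∷ B)
  ...   | no new = stop-here A c B m max straddles minimal new
  ...   | yes crossed-before with ∈-prefixCrossings⁻ A (m ∷ B) crossed-before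
  ...     | A₁ , c' , A₂ , refl , repeated =
    let minimal' = deletion-minimal A₁ c' A₂ B m repeated minimal in
    continue-with A₁ c' A₂ B m repeated c max minimal'
      (run n A₁ (fin c') (A₂ ++ m ∷ B) (ℕP.<-≤-trans (length-<-++-∷ A₁ c' A₂) (ℕP.≤-pred |A|<n)) minimal'
           (deletion-pending A₁ c' A₂ B m repeated straddles minimal'))

mainTheorem11 : (π : ℤ → ℤ) (i : ℤ) (a : List ℤ) →
    (∀ x → perm ⌊ a ⌋ x ≡ π x) → Reduced ⌊ a ⌋ →
    (j0 : ℕ) → 1 ℕ.≤ j0 → j0 ℕ.≤ ℕ.suc (length a) →
    Σ Word λ out → MonkRun i (insert∞ a j0) j0 out ×
      Σ ℤ λ α → Σ ℤ λ β → α ≤ i × i < β × (∀ x → perm out x ≡ π (t α β x))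
mainTheorem11 π i a a≗π a-reduced (suc n₀) _ j₀≤ =
  subst₂ Terminates word position (run (suc (length A)) A ∞ B ℕP.≤-refl minimal (pending-∞ i B))
  where
  open Run π i a a≗π a-reduced
  A = take n₀ a
  B = drop n₀ a
  A++B≡a : A ++ B ≡ a
  A++B≡a = LP.take++drop≡id n₀ a
  word : ⌊ A ⌋ ++ ∞ ∷ ⌊ B ⌋ ≡ insert∞ a (suc n₀)
  word = sym (cong₂ (λ X Y → X ++ ∞ ∷ Y) (LP.take-map n₀ a) (LP.drop-map n₀ a))
  position : suc (length A) ≡ suc n₀
  position = cong suc (trans (LP.length-take n₀ a) (ℕP.m≤n⇒m⊓n≡m (ℕP.≤-pred j₀≤)))
  minimal : MinimalWord (A ++ B)
  minimal = (λ x → trans (cong (λ W → ⟦ W ⟧ x) A++B≡a) (a≗π x)) , cong length A++B≡a
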